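{- Let $w$ be a finite word and let $u$ be a primitive factor of $w$ with $uu\in\mathrm{Fac}(w)$; put $\ell=|u|$ and $M=M(u)$. Then for every integer $1\le i\le \ell$, \[ |\mathbb{Q}\mathrm{Class}_w(u)\cap [u]_{2\ell+M-i}|\le i . \]
   Context: $\mathrm{Fac}(w)$ is the set of factors of $w$. A nonempty word is primitive if it is not $v^k$ for a word $v$ and an integer $k\ge2$. For a nonempty word $p$ and rational $m\ge 1$ with $m|p|$ an integer, $p^m$ denotes $p^{\lfloor m\rfloor}p_0$ with $p_0$ the prefix of $p$ such that $|p^m|=m|p|$. For a word $u$ of length $\ell$, $[u]$ is its conjugacy class (the words $yx$ with $u=xy$), and for an integer $i\ge 1$, $[u]_i$ denotes the set of factors of length $i$ of the infinite periodic word $u^\omega=uuu\cdots$. Define $\mathbb{Q}\mathrm{Class}_w(u)=\{p^m\in\mathrm{Fac}(w)\mid p\in[u],\ m\in\mathbb{Q},\ m\ge 2\}$. For $m\ge \ell$, $C(u,m)=([u]_m,[u]_{m+1})$ is a small circuit of the Rauzy graph $\Gamma_m(w)$ when $[u]_m\subseteq \mathrm{Fac}(w)$ and $[u]_{m+1}\subseteq\mathrm{Fac}(w)$. $M(u)$ is the number of integers $m\ge \ell$ for which $C(u,m)$ is a small circuit; these are exactly $m=\ell,\dots,\ell+M(u)-1$. -}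

module Defs where

open import Data.Nat using (ℕ; _+_; _*_; _∸_; _≤_; _<_)
open import Data.List using (List; []; _++_; length; take; concat; replicate)
open import Data.Product using (Σ; ∃; ∃-syntax; _×_)
open import Relation.Binary.PropositionalEquality using (_≡_; _≢_)
open import Relation.Nullary using (¬_)
open import Function.Bundles using (_⇔_)

module _ {A : Set} where

  Word : Set
  Word = List A

  Fac : Word → Word → Set
  Fac w v = ∃[ x ] ∃[ y ] (x ++ v ++ y ≡ w)

  pow : Word → ℕ → Word
  pow v k = concat (replicate k v)

  Primitive : Word → Set
  Primitive u = (u ≢ []) × (∀ (v : Word) (k : ℕ) → 2 ≤ k → u ≢ pow v k)

  Conj : Word → Word → Set
  Conj u p = ∃[ x ] ∃[ y ] ((u ≡ x ++ y) × (p ≡ y ++ x))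

  -- [u]_i : the factors of length i of u^ω.  For nonempty u, a word of
  -- length i is a factor of u^ω iff it is a factor of some finite power u^n.
  ClassLen : Word → ℕ → Word → Set
  ClassLen u i x = (length x ≡ i) × ∃[ n ] Fac (pow u n) x

  -- fractional power p^m where L = m|p| is the (integer) length:
  -- the prefix of length L of p^ω (= p^⌊m⌋ p₀).
  ratPow : Word → ℕ → Word
  ratPow p L = take L (pow p L)

  -- x ∈ QClass_w(u): x = p^m ∈ Fac(w) with p ∈ [u], m ∈ ℚ, m ≥ 2
  -- (m ≥ 2 with m|p| = L  ⇔  L ≥ 2|p|).
  QClass : Word → Word → Word → Set
  QClass w u x =
    ∃[ p ] ∃[ L ] (Conj u p × (2 * length p ≤ L) × (x ≡ ratPow p L) × Fac w x)

  _⊆_ : (Word → Set) → (Word → Set) → Set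
  P ⊆ Q = ∀ x → P x → Q x

  -- C(u,m) = ([u]_m, [u]_{m+1}) is a small circuit of Γ_m(w)
  SmallCircuit : Word → Word → ℕ → Set
  SmallCircuit w u m = (ClassLen u m ⊆ Fac w) × (ClassLen u (m + 1) ⊆ Fac w)

  IsM : Word → Word → ℕ → Set
  IsM w u M = ∀ m → length u ≤ m → (SmallCircuit w u m ⇔ m < length u + M)

-- Suppose more than i words of QClass_w(u) ∩ [u]_L are given, L = 2ℓ + M − i.  The factors of u^ω are
-- the windows of the ℓ-periodic sequence u^ω, and a window depends only on its start position mod ℓ.
-- Fix y ∈ [u]_n with n ≤ ℓ + M + 1, starting at position t + ℓ, and start every given word at a
-- position t + 1 + d with d < ℓ.  Distinct words have distinct offsets d, so one of them has d ≥ i,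
-- and its window then covers that of y; hence y ∈ Fac(w).  So [u]_{ℓ+M} and [u]_{ℓ+M+1} lie in Fac(w),
-- i.e. C(u, ℓ + M) is a small circuit, contradicting the definition of M.
module Submission where

open import Defs
open import Data.Nat using (ℕ; _+_; _*_; _∸_; _≤_)
open import Data.List using (List; length; _++_)
open import Data.List.Relation.Unary.All using (All)
open import Data.List.Relation.Unary.Unique.Propositional using (Unique)
open import Data.Product using (_×_)

open import Data.Nat using (zero; suc; z≤n; s≤s; _<_; _%_; _≤?_; NonZero)
open import Data.Nat.Properties
open import Data.Nat.DivMod
  using (_mod_; %-distribˡ-+; %-remove-+ˡ; m%n%n≡m%n; m%n≤n; m%n<n; [m+n]%n≡m%n; n%n≡0; m*n%n≡0; m<n⇒m%n≡m)
open import Data.Nat.Divisibility using (∣-refl)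
open import Data.Nat.Tactic.RingSolver using (solve-∀)
open import Data.Fin as Fin using (Fin; toℕ)
open import Data.Fin.Properties using (toℕ<n; fromℕ<-cong; fromℕ<-toℕ)
open import Data.List using ([]; _∷_; lookup; applyUpTo)
open import Data.List.Properties
  using (∷-injectiveˡ; ∷-injectiveʳ; ++-assoc; ++-identityʳ; length-removeAt′; length-applyUpTo)
open import Data.List.Membership.Propositional using (_∈_; _─_)
open import Data.List.Membership.Propositional.Properties using (∈-applyUpTo⁺)
open import Data.List.Relation.Unary.Any using (here; there; index)
open import Data.List.Relation.Unary.All using ([]; _∷_)
import Data.List.Relation.Unary.All as All
open import Data.List.Relation.Unary.AllPairs using ([]; _∷_)
open import Data.Product using (∃-syntax; _,_; proj₁; proj₂)
open import Data.Sum using (_⊎_; inj₁; inj₂)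
open import Function.Base using (_∘_)
open import Function.Bundles using (Equivalence)
open import Relation.Nullary using (yes; no; contradiction)
open import Relation.Binary.PropositionalEquality

suc-%-cong : ∀ {m n} d .{{_ : NonZero d}} → m % d ≡ n % d → suc m % d ≡ suc n % d
suc-%-cong {m} {n} d eq = begin
  (1 + m) % d           ≡⟨ %-distribˡ-+ 1 m d ⟩
  (1 % d + m % d) % d   ≡⟨ cong (λ z → (1 % d + z) % d) eq ⟩
  (1 % d + n % d) % d   ≡⟨ %-distribˡ-+ 1 n d ⟨
  (1 + n) % d           ∎
  where open ≡-Reasoning

∃-offset-% : ∀ ℓ .{{_ : NonZero ℓ}} r s → ∃[ d ] d < ℓ × (r + d) % ℓ ≡ s % ℓ
∃-offset-% ℓ r s = e % ℓ , m%n<n e ℓ , (begin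
  (r + e % ℓ) % ℓ              ≡⟨ %-distribˡ-+ r (e % ℓ) ℓ ⟩
  (r % ℓ + e % ℓ % ℓ) % ℓ      ≡⟨ cong (λ z → (r % ℓ + z) % ℓ) (m%n%n≡m%n e ℓ) ⟩
  (r % ℓ + e % ℓ) % ℓ          ≡⟨ cong (λ z → (z + e % ℓ) % ℓ) (m%n%n≡m%n r ℓ) ⟨
  (r % ℓ % ℓ + e % ℓ) % ℓ      ≡⟨ %-distribˡ-+ (r % ℓ) e ℓ ⟨
  (r % ℓ + e) % ℓ              ≡⟨ cong (_% ℓ) (m+[n∸m]≡n r%ℓ≤ℓ+s%ℓ) ⟩
  (ℓ + s % ℓ) % ℓ              ≡⟨ %-remove-+ˡ (s % ℓ) ∣-refl ⟩
  s % ℓ % ℓ                    ≡⟨ m%n%n≡m%n s ℓ ⟩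
  s % ℓ                        ∎)
  where
  open ≡-Reasoning
  e = ℓ + s % ℓ ∸ r % ℓ
  r%ℓ≤ℓ+s%ℓ = ≤-trans (m%n≤n r ℓ) (m≤m+n ℓ (s % ℓ))

late-start-covers : ∀ {ℓ M i d n} t → i ≤ d → i ≤ ℓ → n ≤ ℓ + M + 1 →
                    t + ℓ + n ≤ suc t + d + (2 * ℓ + M ∸ i)
late-start-covers {ℓ} {M} {i} {d} {n} t i≤d i≤ℓ n≤ = begin
  t + ℓ + n                        ≤⟨ +-monoʳ-≤ (t + ℓ) n≤ ⟩
  t + ℓ + (ℓ + M + 1)              ≡⟨ shuffle t ℓ M ⟩
  suc t + (2 * ℓ + M)              ≡⟨ cong (suc t +_) (m+[n∸m]≡n i≤2ℓ+M) ⟨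
  suc t + (i + (2 * ℓ + M ∸ i))    ≤⟨ +-monoʳ-≤ (suc t) (+-monoˡ-≤ (2 * ℓ + M ∸ i) i≤d) ⟩
  suc t + (d + (2 * ℓ + M ∸ i))    ≡⟨ +-assoc (suc t) d _ ⟨
  suc t + d + (2 * ℓ + M ∸ i)      ∎
  where
  open ≤-Reasoning
  shuffle : ∀ t ℓ M → t + ℓ + (ℓ + M + 1) ≡ suc t + (2 * ℓ + M)
  shuffle = solve-∀
  i≤2ℓ+M : i ≤ 2 * ℓ + M
  i≤2ℓ+M = ≤-trans i≤ℓ (≤-trans (m≤m+n ℓ (ℓ + 0)) (m≤m+n (2 * ℓ) M))

module _ {B : Set} where

  ∈-─ : ∀ {x y : B} {ys} (p : x ∈ ys) → y ∈ ys → x ≢ y → y ∈ ys ─ p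
  ∈-─ (here refl) (here refl) x≢y = contradiction refl x≢y
  ∈-─ (here refl) (there q)   _   = q
  ∈-─ (there p)   (here refl) _   = here refl
  ∈-─ (there p)   (there q)   x≢y = there (∈-─ p q x≢y)

  Unique-⊆⇒length≤ : ∀ {xs ys : List B} → Unique xs → All (_∈ ys) xs → length xs ≤ length ys
  Unique-⊆⇒length≤ [] [] = z≤n
  Unique-⊆⇒length≤ {ys = ys} (x≢xs ∷ xs!) (x∈ys ∷ xs⊆ys) = begin
    suc _                       ≤⟨ s≤s (Unique-⊆⇒length≤ xs! xs⊆ys─x) ⟩
    suc (length (ys ─ x∈ys))    ≡⟨ length-removeAt′ ys (index x∈ys) ⟨
    length ys                   ∎
    where
    open ≤-Reasoning
    xs⊆ys─x = All.zipWith (λ (x≢y , y∈ys) → ∈-─ x∈ys y∈ys x≢y) (x≢xs , xs⊆ys)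

  module _ (g : ℕ → B) {P : ℕ → Set} (i : ℕ) where

    large-index⊎⊆applyUpTo : ∀ {xs} → All (λ x → ∃[ d ] P d × x ≡ g d) xs →
                             (∃[ d ] i ≤ d × P d × g d ∈ xs) ⊎ All (_∈ applyUpTo g i) xs
    large-index⊎⊆applyUpTo [] = inj₂ []
    large-index⊎⊆applyUpTo ((d , pd , refl) ∷ rest) with i ≤? d | large-index⊎⊆applyUpTo rest
    ... | yes i≤d | _                              = inj₁ (d , i≤d , pd , here refl)
    ... | no _    | inj₁ (d′ , i≤d′ , pd′ , d′∈xs) = inj₁ (d′ , i≤d′ , pd′ , there d′∈xs)
    ... | no i≰d  | inj₂ xs⊆                       = inj₂ (∈-applyUpTo⁺ g (≰⇒> i≰d) ∷ xs⊆)

    unique-images⇒large-index : ∀ {xs} → Unique xs → All (λ x → ∃[ d ] P d × x ≡ g d) xs →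
                                i < length xs → ∃[ d ] i ≤ d × P d × g d ∈ xs
    unique-images⇒large-index {xs} xs! images i<|xs| with large-index⊎⊆applyUpTo images
    ... | inj₁ found = found
    ... | inj₂ xs⊆ = contradiction (subst (length xs ≤_) (length-applyUpTo g i) (Unique-⊆⇒length≤ xs! xs⊆))
                                   (<⇒≱ i<|xs|)

module _ {A : Set} where

  Fac-trans : ∀ {w x y : List A} → Fac w x → Fac x y → Fac w y
  Fac-trans {y = y} (a , b , refl) (c , d , refl) = a ++ c , d ++ b , (begin
    (a ++ c) ++ y ++ d ++ b      ≡⟨ ++-assoc a c _ ⟩
    a ++ c ++ y ++ d ++ b        ≡⟨ cong (λ z → a ++ c ++ z) (++-assoc y d b) ⟨
    a ++ c ++ (y ++ d) ++ b      ≡⟨ cong (a ++_) (++-assoc c (y ++ d) b) ⟨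
    a ++ (c ++ y ++ d) ++ b      ∎)
    where open ≡-Reasoning

  Fac-prefix : ∀ (xs ys : List A) → Fac (xs ++ ys) xs
  Fac-prefix xs ys = [] , ys , refl

  Fac-suffix : ∀ (xs ys : List A) → Fac (xs ++ ys) ys
  Fac-suffix xs ys = xs , [] , cong (xs ++_) (++-identityʳ ys)

  window : (ℕ → A) → ℕ → ℕ → List A
  window g s zero    = []
  window g s (suc n) = g s ∷ window g (suc s) n

  window-++ : ∀ (g : ℕ → A) s m n → window g s (m + n) ≡ window g s m ++ window g (s + m) n
  window-++ g s zero    n = cong (λ z → window g z n) (sym (+-identityʳ s))
  window-++ g s (suc m) n = cong (g s ∷_) (trans (window-++ g (suc s) m n)
                                                 (cong (λ z → window g (suc s) m ++ window g z n) (sym (+-suc s m))))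

  window-lookup : ∀ (g : ℕ → A) (xs : List A) s → (∀ k → g (toℕ k + s) ≡ lookup xs k) →
                  window g s (length xs) ≡ xs
  window-lookup g []       s eq = refl
  window-lookup g (x ∷ xs) s eq =
    cong₂ _∷_ (eq Fin.zero) (window-lookup g xs (suc s) (λ k → trans (cong g (+-suc (toℕ k) s)) (eq (Fin.suc k))))

  Fac-window⇒window : ∀ {g : ℕ → A} {s n y} → Fac (window g s n) y →
                      ∃[ r ] y ≡ window g r (length y)
  Fac-window⇒window {g} (a , b , eq) = length a + _ , infix-window a eq
    where
    prefix-window : ∀ y {b s n} → y ++ b ≡ window g s n → y ≡ window g s (length y)
    prefix-window []      _  = refl
    prefix-window (c ∷ y) {n = suc n} eq = cong₂ _∷_ (∷-injectiveˡ eq) (prefix-window y (∷-injectiveʳ eq))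

    infix-window : ∀ a {y b s n} → a ++ y ++ b ≡ window g s n → y ≡ window g (length a + s) (length y)
    infix-window []      eq = prefix-window _ eq
    infix-window (c ∷ a) {y} {s = s} {n = suc n} eq =
      trans (infix-window a (∷-injectiveʳ eq)) (cong (λ z → window g z (length y)) (+-suc (length a) s))

  Fac-subwindow : ∀ (g : ℕ → A) {s r m n} → s ≤ r → r + n ≤ s + m → Fac (window g s m) (window g r n)
  Fac-subwindow g {s} {m = m} {n} s≤r r+n≤s+m
    with p , refl ← m≤n⇒∃[o]m+o≡n s≤r
    with q , refl ← m≤n⇒∃[o]m+o≡n (+-cancelˡ-≤ s (p + n) m (subst (_≤ s + m) (+-assoc s p n) r+n≤s+m))
    =
      Fac-trans (subst (λ v → Fac v (window g s (p + n))) (sym (window-++ g s (p + n) q)) (Fac-prefix _ _))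
                (subst (λ v → Fac v (window g (s + p) n)) (sym (window-++ g s p n)) (Fac-suffix (window g s p) _))

module Periodic {A : Set} (u : List A) .{{_ : NonZero (length u)}} where

  ℓ : ℕ
  ℓ = length u

  u^ω : ℕ → A
  u^ω j = lookup u (j mod ℓ)

  u^ω-% : ∀ {j k} → j % ℓ ≡ k % ℓ → u^ω j ≡ u^ω k
  u^ω-% eq = cong (lookup u) (fromℕ<-cong _ _ eq _ _)

  u^ω-lookup : ∀ (k : Fin ℓ) → u^ω (toℕ k) ≡ lookup u k
  u^ω-lookup k =
    cong (lookup u) (trans (fromℕ<-cong _ _ (m<n⇒m%n≡m (toℕ<n k)) _ (toℕ<n k)) (fromℕ<-toℕ k _))

  window-% : ∀ {s r} n → s % ℓ ≡ r % ℓ → window u^ω s n ≡ window u^ω r n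
  window-% zero    eq = refl
  window-% (suc n) eq = cong₂ _∷_ (u^ω-% eq) (window-% n (suc-%-cong ℓ eq))

  u≡window : u ≡ window u^ω 0 ℓ
  u≡window = sym (window-lookup u^ω u 0 (λ k → trans (cong u^ω (+-identityʳ (toℕ k))) (u^ω-lookup k)))

  pow≡window : ∀ N → pow u N ≡ window u^ω 0 (N * ℓ)
  pow≡window zero    = refl
  pow≡window (suc N) = begin
    u ++ pow u N                             ≡⟨ cong₂ _++_ u≡window (pow≡window N) ⟩
    window u^ω 0 ℓ ++ window u^ω 0 (N * ℓ)   ≡⟨ cong (window u^ω 0 ℓ ++_) (window-% (N * ℓ) 0%ℓ≡ℓ%ℓ) ⟩
    window u^ω 0 ℓ ++ window u^ω ℓ (N * ℓ)   ≡⟨ window-++ u^ω 0 ℓ (N * ℓ) ⟨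
    window u^ω 0 (ℓ + N * ℓ)                 ∎
    where
    open ≡-Reasoning
    0%ℓ≡ℓ%ℓ : 0 % ℓ ≡ ℓ % ℓ
    0%ℓ≡ℓ%ℓ = trans (m*n%n≡0 0 ℓ) (sym (n%n≡0 ℓ))

  ClassLen⇒window : ∀ {n y} → ClassLen u n y → ∃[ s ] y ≡ window u^ω s n
  ClassLen⇒window (refl , N , y∈Fac) = Fac-window⇒window (subst (λ v → Fac v _) (pow≡window N) y∈Fac)

  ClassLen⇒window-from : ∀ r {n x} → ClassLen u n x → ∃[ d ] d < ℓ × x ≡ window u^ω (r + d) n
  ClassLen⇒window-from r {n} x∈[u]n
    with s , refl ← ClassLen⇒window x∈[u]n
    with d , d<ℓ , eq ← ∃-offset-% ℓ r s
    = d , d<ℓ , window-% n (sym eq)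

  ClassLen⊆Fac : ∀ {w : List A} M i {xs} → i ≤ ℓ → Unique xs →
                 All (λ x → Fac w x × ClassLen u (2 * ℓ + M ∸ i) x) xs → i < length xs →
                 ∀ n → n ≤ ℓ + M + 1 → ClassLen u n ⊆ Fac w
  ClassLen⊆Fac {w} M i {xs} i≤ℓ xs! X i<|xs| n n≤ y y∈[u]n
    with t , refl ← ClassLen⇒window y∈[u]n = y∈Fac
    where
    L = 2 * ℓ + M ∸ i

    x : ℕ → List A
    x d = window u^ω (suc t + d) L

    late : ∃[ d ] i ≤ d × d < ℓ × x d ∈ xs
    late = unique-images⇒large-index x i xs! (All.map (ClassLen⇒window-from (suc t) ∘ proj₂) X)
                                     i<|xs|

    y∈Fac : Fac w (window u^ω t n)
    y∈Fac with d , i≤d , d<ℓ , x∈xs ← late =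
      Fac-trans (All.lookup (All.map proj₁ X) x∈xs)
                (subst (Fac (x d)) (window-% n ([m+n]%n≡m%n t ℓ))
                       (Fac-subwindow u^ω (subst (_≤ t + ℓ) (+-suc t d) (+-monoʳ-≤ t d<ℓ))
                                          (late-start-covers t i≤d i≤ℓ n≤)))

lemma6 : {A : Set} (w u : List A) (M : ℕ) →
    Primitive u → Fac w u → Fac w (u ++ u) → IsM w u M →
    (i : ℕ) → 1 ≤ i → i ≤ length u →
    (xs : List (List A)) → Unique xs →
    All (λ x → QClass w u x × ClassLen u (2 * length u + M ∸ i) x) xs →
    length xs ≤ i
lemma6 w []        M (u≢[] , _) _ _ _   _ _ _   _  _   _ = contradiction refl u≢[]
lemma6 w u@(_ ∷ _) M _          _ _ isM i _ i≤ℓ xs xs! X with length xs ≤? i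
... | yes |xs|≤i = |xs|≤i
... | no  |xs|≰i = contradiction (Equivalence.to (isM (ℓ + M) (m≤m+n ℓ M)) circuit) (n≮n (ℓ + M))
  where
  open Periodic u

  X′ : All (λ x → Fac w x × ClassLen u (2 * ℓ + M ∸ i) x) xs
  X′ = All.map (λ ((_ , _ , _ , _ , _ , x∈Fac) , x∈[u]) → x∈Fac , x∈[u]) X

  covered : ∀ n → n ≤ ℓ + M + 1 → ClassLen u n ⊆ Fac w
  covered = ClassLen⊆Fac M i i≤ℓ xs! X′ (≰⇒> |xs|≰i)

  circuit : SmallCircuit w u (ℓ + M)
  circuit = covered (ℓ + M) (m≤m+n (ℓ + M) 1) , covered (ℓ + M + 1) ≤-refl
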